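{- If $H$ is a layered graph (resp. an induced layered graph), then there is a sufficiently large $N$ such that every $2$-coloring of the vertices of $K_3^{\square N}$ contains a monochromatic copy (resp. induced copy) of $H$.
   Context: $K_3^{\square N}$ is the $N$-th Cartesian power of the triangle $K_3$; equivalently, its vertex set is $[3]^N$ and two vertices are adjacent iff they differ in exactly one coordinate. The hypercube $Q_d$ has vertex set $\{0,1\}^d$ with two vertices adjacent iff they differ in exactly one coordinate; its $k$-th vertex layer is the set of vertices with exactly $k$ ones, and its $k$-th edge layer is the subgraph induced by the $k$-th and $(k-1)$-th vertex layers. A graph is (induced) layered if it is an (induced) subgraph of an edge layer of some hypercube. -}

module Defs where

open import Data.Nat using (ℕ; zero; suc; _+_; _≥_)
open import Data.Fin using (Fin)
open import Data.Bool using (Bool; true; false)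
open import Data.Vec using (Vec; []; _∷_; lookup)
open import Data.Product using (Σ; ∃; ∃-syntax; _×_; _,_)
open import Data.Sum using (_⊎_)
open import Relation.Nullary using (¬_)
open import Relation.Binary.PropositionalEquality using (_≡_; _≢_)
open import Function.Definitions using (Injective)
open import Function.Bundles using (_⇔_)

record Graph (n : ℕ) : Set₁ where
  field
    Adj   : Fin n → Fin n → Set
    sym   : ∀ {u v} → Adj u v → Adj v u
    irrfl : ∀ {u} → ¬ Adj u u
open Graph public

DifferInOne : {A : Set} {m : ℕ} → Vec A m → Vec A m → Set
DifferInOne {m = m} x y =
  ∃[ i ] (lookup x i ≢ lookup y i × (∀ (j : Fin m) → j ≢ i → lookup x j ≡ lookup y j))

-- Hypercube Q_d: vertices Vec Bool d (true = 1), adjacency = differ in one coordinate.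
QVertex : ℕ → Set
QVertex d = Vec Bool d

QAdj : {d : ℕ} → QVertex d → QVertex d → Set
QAdj = DifferInOne

ones : {d : ℕ} → QVertex d → ℕ
ones []          = 0
ones (true ∷ x)  = suc (ones x)
ones (false ∷ x) = ones x

-- K_3^{□N}: vertices [3]^N = Vec (Fin 3) N, adjacency = differ in one coordinate.
K3Vertex : ℕ → Set
K3Vertex N = Vec (Fin 3) N

K3Adj : {N : ℕ} → K3Vertex N → K3Vertex N → Set
K3Adj = DifferInOne

-- The k-th edge layer (k ≥ 1), written with k = suc j: vertices with j or suc j ones.
InEdgeLayer : {d : ℕ} → ℕ → QVertex d → Set
InEdgeLayer j x = ones x ≡ j ⊎ ones x ≡ suc j

Layered : {n : ℕ} → Graph n → Set
Layered {n} H =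
  ∃[ d ] ∃[ j ] Σ (Fin n → QVertex d) λ f →
    Injective _≡_ _≡_ f ×
    (∀ v → InEdgeLayer j (f v)) ×
    (∀ u v → Adj H u v → QAdj (f u) (f v))

InducedLayered : {n : ℕ} → Graph n → Set
InducedLayered {n} H =
  ∃[ d ] ∃[ j ] Σ (Fin n → QVertex d) λ f →
    Injective _≡_ _≡_ f ×
    (∀ v → InEdgeLayer j (f v)) ×
    (∀ u v → Adj H u v ⇔ QAdj (f u) (f v))

Colouring : ℕ → Set
Colouring N = K3Vertex N → Fin 2

MonoCopy : {n : ℕ} → Graph n → (N : ℕ) → Colouring N → Set
MonoCopy {n} H N c =
  Σ (Fin n → K3Vertex N) λ g →
    Injective _≡_ _≡_ g ×
    (∀ u v → Adj H u v → K3Adj (g u) (g v)) ×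
    ∃[ χ ] (∀ v → c (g v) ≡ χ)

MonoInducedCopy : {n : ℕ} → Graph n → (N : ℕ) → Colouring N → Set
MonoInducedCopy {n} H N c =
  Σ (Fin n → K3Vertex N) λ g →
    Injective _≡_ _≡_ g ×
    (∀ u v → Adj H u v ⇔ K3Adj (g u) (g v)) ×
    ∃[ χ ] (∀ v → c (g v) ≡ χ)

{-# OPTIONS --safe #-}
module Submission where

-- Ramsey's theorem, applied simultaneously to the colourings ψ ↦ c(σ on the coordinates ψ, 0 elsewhere)
-- of the t-sets ψ of coordinates, for all words σ ∈ {1,2}^t with t ≤ m, yields an m-dimensional
-- coordinate subcube of [3]^N on which the colour of a vertex depends only on its word of nonzero
-- letters.  On such words, take d + 1 runs of j equal letters, alternating between the two letters and
-- separated by d slots; a vertex x of Q_d fills slot i with the letter of the run before or after it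
-- according to x_i, which embeds Q_d as an induced subgraph.  Filling the slots one at a time lengthens
-- one run from j to j + 1 letters at each step.  If no step keeps the colour, each one flips it, so the
-- whole copy of Q_d is monochromatic.  Otherwise the colour of X a^j Y equals that of X a^(j+1) Y for
-- some words X, Y and letter a; the d-cube of words X s₁⋯s_d Y with s_i ∈ {0, a} then has a
-- monochromatic j-th edge layer, since deleting zeros turns its layers j and j + 1 into X a^j Y and
-- X a^(j+1) Y.  A layered graph sits inside such a layer.

open import Data.Bool using (Bool; true; false; not; _xor_)
open import Data.Empty using (⊥-elim)
open import Data.Fin using (Fin; zero; suc; _≟_)
open import Data.Fin.Properties using (suc-injective)
open import Data.List using (List; []; _∷_; length; _++_; replicate)
open import Data.List.Properties using (length-++; length-replicate; ++-assoc; ++-identityʳ)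
open import Data.Nat using (ℕ; zero; suc; _+_; _≤_; _<_; _≥_; z≤n; s≤s)
open import Data.Nat.Properties
  using (≤-refl; ≤-trans; n≤1+n; +-suc; m≤n⇒m<n∨m≡n; +-monoʳ-≤; +-monoˡ-≤; m≤n+m; m≤m+n;
         module ≤-Reasoning)
open import Data.Nat.Solver using (module +-*-Solver)
open import Data.Product using (Σ; ∃-syntax; _×_; _,_; proj₁; proj₂)
open import Data.Sum using (_⊎_; inj₁; inj₂; [_,_])
import Data.Sum as Sum
open import Data.Unit using (⊤; tt)
open import Data.Vec using (Vec; []; _∷_; lookup; fromList)
import Data.Vec as Vec
open import Data.Vec.Properties using (∷-injectiveˡ; ∷-injectiveʳ)
open import Data.Vec.Relation.Binary.Pointwise.Extensional using (ext; Pointwise-≡⇒≡)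
open import Function using (_∘_; id)
open import Function.Bundles using (_⇔_; mk⇔; Equivalence)
open import Function.Definitions using (Injective)
open import Relation.Binary.PropositionalEquality
  using (_≡_; _≢_; refl; sym; trans; cong; cong₂; subst; module ≡-Reasoning)
open import Relation.Nullary using (yes; no)

open import Defs hiding (sym)

private variable
  A B C I J : Set
  d e j k m n r t u K N : ℕ

-- Thin m n: the order-preserving embeddings of Fin m into Fin n, i.e. the m-subsets of an n-set.
data Thin : ℕ → ℕ → Set where
  done : Thin 0 0
  skip : Thin m n → Thin m (suc n)
  keep : Thin m n → Thin (suc m) (suc n)

infixr 9 _⊚_
_⊚_ : Thin m n → Thin k m → Thin k n
done   ⊚ done   = done
skip θ ⊚ ψ      = skip (θ ⊚ ψ)
keep θ ⊚ skip ψ = skip (θ ⊚ ψ)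
keep θ ⊚ keep ψ = keep (θ ⊚ ψ)

⊚-assoc : ∀ {a b c d} (θ : Thin c d) (ψ : Thin b c) (φ : Thin a b) →
          (θ ⊚ ψ) ⊚ φ ≡ θ ⊚ (ψ ⊚ φ)
⊚-assoc done     done     done     = refl
⊚-assoc (skip θ) ψ        φ        = cong skip (⊚-assoc θ ψ φ)
⊚-assoc (keep θ) (skip ψ) φ        = cong skip (⊚-assoc θ ψ φ)
⊚-assoc (keep θ) (keep ψ) (skip φ) = cong skip (⊚-assoc θ ψ φ)
⊚-assoc (keep θ) (keep ψ) (keep φ) = cong keep (⊚-assoc θ ψ φ)

initial : m ≤ n → Thin m n
initial {n = zero}  z≤n     = done
initial {n = suc n} z≤n     = skip (initial z≤n)
initial             (s≤s p) = keep (initial p)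

thin⇒≤ : Thin m n → m ≤ n
thin⇒≤ done     = z≤n
thin⇒≤ (skip θ) = ≤-trans (thin⇒≤ θ) (n≤1+n _)
thin⇒≤ (keep θ) = s≤s (thin⇒≤ θ)

thin₀-unique : (ψ φ : Thin 0 n) → ψ ≡ φ
thin₀-unique done     done     = refl
thin₀-unique (skip ψ) (skip φ) = cong skip (thin₀-unique ψ φ)

emb : Thin m n → Fin m → Fin n
emb (skip θ) i       = suc (emb θ i)
emb (keep θ) zero    = zero
emb (keep θ) (suc i) = suc (emb θ i)

emb-⊚ : (θ : Thin m n) (ψ : Thin k m) (i : Fin k) → emb (θ ⊚ ψ) i ≡ emb θ (emb ψ i)
emb-⊚ done     done     ()
emb-⊚ (skip θ) ψ        i       = cong suc (emb-⊚ θ ψ i)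
emb-⊚ (keep θ) (skip ψ) i       = cong suc (emb-⊚ θ ψ i)
emb-⊚ (keep θ) (keep ψ) zero    = refl
emb-⊚ (keep θ) (keep ψ) (suc i) = cong suc (emb-⊚ θ ψ i)

first : Thin (suc t) n → Fin n
first ψ = emb ψ zero

MonochromaticSubsequence : Fin 2 → (r : ℕ) → Vec (Fin 2) k → Set
MonochromaticSubsequence b r cs = Σ (Thin r _) λ θ → ∀ i → lookup cs (emb θ i) ≡ b

module _ {b : Fin 2} where

  mono-empty : (cs : Vec (Fin 2) k) → MonochromaticSubsequence b 0 cs
  mono-empty cs = initial z≤n , λ ()

  mono-skip : ∀ {c} {cs : Vec (Fin 2) k} →
              MonochromaticSubsequence b r cs → MonochromaticSubsequence b r (c ∷ cs)
  mono-skip (θ , h) = skip θ , h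

  mono-keep : {cs : Vec (Fin 2) k} →
              MonochromaticSubsequence b r cs → MonochromaticSubsequence b (suc r) (b ∷ cs)
  mono-keep (θ , h) = keep θ , λ { zero → refl ; (suc i) → h i }

pigeonhole : (cs : Vec (Fin 2) k) (a b : ℕ) → a + b < k →
             MonochromaticSubsequence zero a cs ⊎ MonochromaticSubsequence (suc zero) b cs
pigeonhole cs          zero    b       _       = inj₁ (mono-empty cs)
pigeonhole cs          (suc a) zero    _       = inj₂ (mono-empty cs)
pigeonhole (zero ∷ cs) (suc a) (suc b) (s≤s p) with pigeonhole cs a (suc b) p
... | inj₁ s = inj₁ (mono-keep s)
... | inj₂ s = inj₂ (mono-skip s)
pigeonhole {suc k} (suc zero ∷ cs) (suc a) (suc b) (s≤s p)
  with pigeonhole cs (suc a) b (subst (_≤ k) (+-suc (suc a) b) p)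
... | inj₁ s = inj₁ (mono-skip s)
... | inj₂ s = inj₂ (mono-keep s)

pigeonhole-half : (cs : Vec (Fin 2) (suc (m + m))) → ∃[ b ] MonochromaticSubsequence b m cs
pigeonhole-half {m} cs with pigeonhole cs m m ≤-refl
... | inj₁ s = zero , s
... | inj₂ s = suc zero , s

-- Ramsey's theorem for thinnings

Monochromatic : (Thin u n → Fin 2) → Thin m n → Fin 2 → Set
Monochromatic χ θ b = ∀ ψ → χ (θ ⊚ ψ) ≡ b

Homogeneous : (Thin u n → Fin 2) → Thin m n → Set
Homogeneous χ θ = ∃[ b ] Monochromatic χ θ b

homogeneous-⊚ : (χ : Thin u n → Fin 2) (θ : Thin m n) {φ : Thin k m} →
                Homogeneous (λ ψ → χ (θ ⊚ ψ)) φ → Homogeneous χ (θ ⊚ φ)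
homogeneous-⊚ χ θ {φ} (b , h) = b , λ ψ → trans (cong χ (⊚-assoc θ φ ψ)) (h ψ)

homogeneous-restrict : (χ : Thin u n → Fin 2) {θ : Thin m n} (φ : Thin k m) →
                       Homogeneous χ θ → Homogeneous χ (θ ⊚ φ)
homogeneous-restrict χ {θ} φ (b , h) = homogeneous-⊚ χ θ (b , λ ψ → h (φ ⊚ ψ))

Ramsey : ℕ → ℕ → Set
Ramsey u m = ∃[ R ] ∀ {n} → R ≤ n → (χ : Thin u n → Fin 2) → Σ (Thin m n) (Homogeneous χ)

module RamseyStep (t : ℕ) (ramsey-t : ∀ m → Ramsey t m) where

  bound : ℕ → ℕ
  bound zero    = zero
  bound (suc k) = suc (proj₁ (ramsey-t (bound k)))

  colour-by-first : ∀ k (χ : Thin (suc t) (bound k) → Fin 2) →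
    Σ (Thin k (bound k)) λ θ → Σ (Vec (Fin 2) k) λ cs → ∀ ψ → χ (θ ⊚ ψ) ≡ lookup cs (first ψ)
  colour-by-first zero    χ = done , [] , λ ()
  colour-by-first (suc k) χ with proj₂ (ramsey-t (bound k)) ≤-refl (χ ∘ keep)
  ... | θ₁ , b , h₁ with colour-by-first k (λ ψ → χ (skip (θ₁ ⊚ ψ)))
  ... | θ₂ , cs , h₂ = keep (θ₁ ⊚ θ₂) , b ∷ cs , by-first
    where
    by-first : ∀ ψ → χ (keep (θ₁ ⊚ θ₂) ⊚ ψ) ≡ lookup (b ∷ cs) (first ψ)
    by-first (skip ψ) = trans (cong (χ ∘ skip) (⊚-assoc θ₁ θ₂ ψ)) (h₂ ψ)
    by-first (keep ψ) = trans (cong (χ ∘ keep) (⊚-assoc θ₁ θ₂ ψ)) (h₁ (θ₂ ⊚ ψ))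

  ramsey-suc : ∀ m → Ramsey (suc t) m
  ramsey-suc m = bound (suc (m + m)) , homogenise
    where
    homogenise : bound (suc (m + m)) ≤ n → (χ : Thin (suc t) n → Fin 2) → Σ (Thin m n) (Homogeneous χ)
    homogenise R≤n χ with colour-by-first (suc (m + m)) (λ ψ → χ (initial R≤n ⊚ ψ))
    ... | θ , cs , h with pigeonhole-half cs
    ... | b , σ , hσ = initial R≤n ⊚ (θ ⊚ σ) ,
                       homogeneous-⊚ χ (initial R≤n) (homogeneous-⊚ χ′ θ (b , monochromatic))
      where
      χ′ : Thin (suc t) (bound (suc (m + m))) → Fin 2
      χ′ ψ = χ (initial R≤n ⊚ ψ)
      monochromatic : ∀ ψ → χ′ (θ ⊚ (σ ⊚ ψ)) ≡ b
      monochromatic ψ = begin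
        χ′ (θ ⊚ (σ ⊚ ψ))            ≡⟨ h (σ ⊚ ψ) ⟩
        lookup cs (first (σ ⊚ ψ))   ≡⟨ cong (lookup cs) (emb-⊚ σ ψ zero) ⟩
        lookup cs (emb σ (first ψ)) ≡⟨ hσ (first ψ) ⟩
        b                           ∎
        where open ≡-Reasoning

ramsey : ∀ u m → Ramsey u m
ramsey zero    m = m , λ R≤n χ → initial R≤n , χ (initial R≤n ⊚ initial z≤n) ,
  λ ψ → cong (λ φ → χ (initial R≤n ⊚ φ)) (thin₀-unique ψ (initial z≤n))
ramsey (suc t) = RamseyStep.ramsey-suc t (ramsey t)

SimultaneousRamsey : Set → ℕ → Set
SimultaneousRamsey I u = ∀ m → ∃[ R ] ∀ {n} → R ≤ n → (χ : I → Thin u n → Fin 2) →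
                         Σ (Thin m n) λ θ → ∀ i → Homogeneous (χ i) θ

simultaneous-⊤ : SimultaneousRamsey ⊤ u
simultaneous-⊤ {u = u} m with ramsey u m
... | R , homogenise = R , λ R≤n χ → let θ , h = homogenise R≤n (χ tt) in θ , λ { tt → h }

simultaneous-⊎ : SimultaneousRamsey I u → SimultaneousRamsey J u → SimultaneousRamsey (I ⊎ J) u
simultaneous-⊎ {I = I} {u = u} {J = J} ramsey-I ramsey-J m with ramsey-J m
... | R₂ , homogenise₂ with ramsey-I R₂
... | R₁ , homogenise₁ = R₁ , homogenise
  where
  homogenise : R₁ ≤ n → (χ : I ⊎ J → Thin u n → Fin 2) →
               Σ (Thin m n) λ θ → ∀ i → Homogeneous (χ i) θ
  homogenise R₁≤n χ with homogenise₁ R₁≤n (χ ∘ inj₁)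
  ... | θ₁ , h₁ with homogenise₂ ≤-refl (λ j ψ → χ (inj₂ j) (θ₁ ⊚ ψ))
  ... | θ₂ , h₂ = θ₁ ⊚ θ₂ , λ where
    (inj₁ i) → homogeneous-restrict (χ (inj₁ i)) θ₂ (h₁ i)
    (inj₂ j) → homogeneous-⊚ (χ (inj₂ j)) θ₁ (h₂ j)

simultaneous-retract : (f : J → I) (g : I → J) → (∀ j → g (f j) ≡ j) →
                       SimultaneousRamsey I u → SimultaneousRamsey J u
simultaneous-retract f g gf ramsey-I m with ramsey-I m
... | R , homogenise = R , λ R≤n χ → let θ , h = homogenise R≤n (χ ∘ g) in
  θ , λ j → subst (λ j′ → Homogeneous (χ j′) θ) (gf j) (h (f j))

simultaneous-Vec : ∀ k → SimultaneousRamsey (Vec Bool k) u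
simultaneous-Vec zero    = simultaneous-retract _ (λ _ → []) (λ { [] → refl }) simultaneous-⊤
simultaneous-Vec (suc k) =
  simultaneous-retract split [ true ∷_ , false ∷_ ] (λ { (true ∷ σ) → refl ; (false ∷ σ) → refl })
    (simultaneous-⊎ (simultaneous-Vec k) (simultaneous-Vec k))
  where
  split : Vec Bool (suc k) → Vec Bool k ⊎ Vec Bool k
  split (true  ∷ σ) = inj₁ σ
  split (false ∷ σ) = inj₂ σ

simultaneous-arities : (I : ℕ → Set) → (∀ t → SimultaneousRamsey (I t) t) → ∀ T m →
  ∃[ R ] ∀ {n} → R ≤ n → (χ : ∀ t → I t → Thin t n → Fin 2) →
  Σ (Thin m n) λ θ → ∀ t → t < T → ∀ i → Homogeneous (χ t i) θ
simultaneous-arities I ramsey-I zero    m = m , λ R≤n χ → initial R≤n , λ _ ()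
simultaneous-arities I ramsey-I (suc T) m with simultaneous-arities I ramsey-I T m
... | R₂ , homogenise₂ with ramsey-I T R₂
... | R₁ , homogenise₁ = R₁ , homogenise
  where
  homogenise : R₁ ≤ n → (χ : ∀ t → I t → Thin t n → Fin 2) →
               Σ (Thin m n) λ θ → ∀ t → t < suc T → ∀ i → Homogeneous (χ t i) θ
  homogenise R₁≤n χ with homogenise₁ R₁≤n (χ T)
  ... | θ₁ , h₁ with homogenise₂ ≤-refl (λ t i ψ → χ t i (θ₁ ⊚ ψ))
  ... | θ₂ , h₂ = θ₁ ⊚ θ₂ , homogeneous
    where
    homogeneous : ∀ t → t < suc T → ∀ i → Homogeneous (χ t i) (θ₁ ⊚ θ₂)
    homogeneous t (s≤s t≤T) i with m≤n⇒m<n∨m≡n t≤T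
    ... | inj₁ t<T  = homogeneous-⊚ (χ t i) θ₁ (h₂ t t<T i)
    ... | inj₂ refl = homogeneous-restrict (χ T i) θ₂ (h₁ i)

-- Induced embeddings of cubes

data OneApart {A : Set} : Vec A n → Vec A n → Set where
  here  : ∀ {x y} {xs ys : Vec A n} → x ≢ y → xs ≡ ys → OneApart (x ∷ xs) (y ∷ ys)
  there : ∀ {x y} {xs ys : Vec A n} → x ≡ y → OneApart xs ys → OneApart (x ∷ xs) (y ∷ ys)

differInOne⇒oneApart : {xs ys : Vec A n} → DifferInOne xs ys → OneApart xs ys
differInOne⇒oneApart {xs = x ∷ xs} {y ∷ ys} (zero , x≢y , rest) =
  here x≢y (Pointwise-≡⇒≡ (ext λ i → rest (suc i) λ ()))
differInOne⇒oneApart {xs = x ∷ xs} {y ∷ ys} (suc i , differ , rest) =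
  there (rest zero λ ())
        (differInOne⇒oneApart (i , differ , λ j j≢i → rest (suc j) (j≢i ∘ suc-injective)))

oneApart⇒differInOne : {xs ys : Vec A n} → OneApart xs ys → DifferInOne xs ys
oneApart⇒differInOne (here x≢y refl) = zero , x≢y , λ where
  zero    0≢0 → ⊥-elim (0≢0 refl)
  (suc j) _   → refl
oneApart⇒differInOne (there x≡y apart) with oneApart⇒differInOne apart
... | i , differ , rest = suc i , differ , λ where
  zero    _   → x≡y
  (suc j) j≢i → rest j (j≢i ∘ cong suc)

record InducedEmbedding (f : Vec A d → Vec B K) : Set where
  field
    injective : Injective _≡_ _≡_ f
    preserves : ∀ {x y} → OneApart x y → OneApart (f x) (f y)
    reflects  : ∀ {x y} → OneApart (f x) (f y) → OneApart x y

  preserves-differInOne : ∀ {x y} → DifferInOne x y → DifferInOne (f x) (f y)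
  preserves-differInOne = oneApart⇒differInOne ∘ preserves ∘ differInOne⇒oneApart

  reflects-differInOne : ∀ {x y} → DifferInOne (f x) (f y) → DifferInOne x y
  reflects-differInOne = oneApart⇒differInOne ∘ reflects ∘ differInOne⇒oneApart

induced-∘ : {f : Vec A d → Vec B e} {g : Vec B e → Vec C K} →
            InducedEmbedding g → InducedEmbedding f → InducedEmbedding (g ∘ f)
induced-∘ g f = record
  { injective = F.injective ∘ G.injective
  ; preserves = G.preserves ∘ F.preserves
  ; reflects  = F.reflects ∘ G.reflects
  }
  where
  module F = InducedEmbedding f
  module G = InducedEmbedding g

data Template (A : Set) : ℕ → ℕ → Set where
  []    : Template A 0 0
  fixed : Fin 3 → Template A d K → Template A d (suc K)
  free  : (s : A → Fin 3) → Injective _≡_ _≡_ s → Template A d K → Template A (suc d) (suc K)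

instantiate : Template A d K → Vec A d → Vec (Fin 3) K
instantiate []           []      = []
instantiate (fixed a T)  x       = a ∷ instantiate T x
instantiate (free s _ T) (b ∷ x) = s b ∷ instantiate T x

instantiate-induced : (T : Template A d K) → InducedEmbedding (instantiate T)
instantiate-induced T = record { injective = injective T ; preserves = preserves T ; reflects = reflects T }
  where
  injective : (T : Template A d K) → Injective _≡_ _≡_ (instantiate T)
  injective []                     {[]}    {[]}    _  = refl
  injective (fixed a T)                            eq = injective T (∷-injectiveʳ eq)
  injective (free s s-injective T) {a ∷ x} {b ∷ y} eq =
    cong₂ _∷_ (s-injective (∷-injectiveˡ eq)) (injective T (∷-injectiveʳ eq))

  preserves : (T : Template A d K) → ∀ {x y} → OneApart x y → OneApart (instantiate T x) (instantiate T y)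
  preserves (fixed a T)            apart              = there refl (preserves T apart)
  preserves (free s s-injective T) (here a≢b refl)    = here (a≢b ∘ s-injective) refl
  preserves (free s _ T)           (there refl apart) = there refl (preserves T apart)

  reflects : (T : Template A d K) → ∀ {x y} → OneApart (instantiate T x) (instantiate T y) → OneApart x y
  reflects (fixed a T)            (here a≢a _)    = ⊥-elim (a≢a refl)
  reflects (fixed a T)            (there _ apart) = reflects T apart
  reflects (free s s-injective T) {a ∷ x} {b ∷ y} (here sa≢sb eq) = here (sa≢sb ∘ cong s) (injective T eq)
  reflects (free s s-injective T) {a ∷ x} {b ∷ y} (there sa≡sb apart) =
    there (s-injective sa≡sb) (reflects T apart)

-- Colourings of [3]^m that only see the nonzero letters

thinning : Thin t k → Template (Fin 3) t k
thinning done     = []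
thinning (skip θ) = fixed zero (thinning θ)
thinning (keep θ) = free id id (thinning θ)

weave : Thin t k → Vec (Fin 3) t → Vec (Fin 3) k
weave θ = instantiate (thinning θ)

weave-⊚ : (θ : Thin m n) (ψ : Thin t m) (a : Vec (Fin 3) t) → weave (θ ⊚ ψ) a ≡ weave θ (weave ψ a)
weave-⊚ done     done     []      = refl
weave-⊚ (skip θ) ψ        a       = cong (zero ∷_) (weave-⊚ θ ψ a)
weave-⊚ (keep θ) (skip ψ) a       = cong (zero ∷_) (weave-⊚ θ ψ a)
weave-⊚ (keep θ) (keep ψ) (x ∷ a) = cong (x ∷_) (weave-⊚ θ ψ a)

letter : Bool → Fin 3
letter true  = suc zero
letter false = suc (suc zero)

letters : Vec Bool t → Vec (Fin 3) t
letters = Vec.map letter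

consNonzero : Fin 3 → List Bool → List Bool
consNonzero zero             w = w
consNonzero (suc zero)       w = true ∷ w
consNonzero (suc (suc zero)) w = false ∷ w

consNonzero-letter : ∀ b (w : List Bool) → consNonzero (letter b) w ≡ b ∷ w
consNonzero-letter true  w = refl
consNonzero-letter false w = refl

nonzeros : Vec (Fin 3) k → List Bool
nonzeros []      = []
nonzeros (a ∷ v) = consNonzero a (nonzeros v)

length-nonzeros : (a : Vec (Fin 3) k) → length (nonzeros a) ≤ k
length-nonzeros []                   = z≤n
length-nonzeros (zero ∷ a)           = ≤-trans (length-nonzeros a) (n≤1+n _)
length-nonzeros (suc zero ∷ a)       = s≤s (length-nonzeros a)
length-nonzeros (suc (suc zero) ∷ a) = s≤s (length-nonzeros a)

nonzeros-weave : (ψ : Thin t k) (a : Vec (Fin 3) t) → nonzeros (weave ψ a) ≡ nonzeros a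
nonzeros-weave done     []      = refl
nonzeros-weave (skip ψ) a       = nonzeros-weave ψ a
nonzeros-weave (keep ψ) (x ∷ a) = cong (consNonzero x) (nonzeros-weave ψ a)

support : (a : Vec (Fin 3) k) → Thin (length (nonzeros a)) k
support []                   = done
support (zero ∷ a)           = skip (support a)
support (suc zero ∷ a)       = keep (support a)
support (suc (suc zero) ∷ a) = keep (support a)

weave-support : (a : Vec (Fin 3) k) → weave (support a) (letters (fromList (nonzeros a))) ≡ a
weave-support []                   = refl
weave-support (zero ∷ a)           = cong (zero ∷_) (weave-support a)
weave-support (suc zero ∷ a)       = cong (suc zero ∷_) (weave-support a)
weave-support (suc (suc zero) ∷ a) = cong (suc (suc zero) ∷_) (weave-support a)

padded : List Bool → Vec (Fin 3) m
padded {zero}  _       = []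
padded {suc m} []      = zero ∷ padded []
padded {suc m} (b ∷ w) = letter b ∷ padded w

nonzeros-padded : (w : List Bool) → length w ≤ m → nonzeros (padded {m} w) ≡ w
nonzeros-padded {zero}  []      _       = refl
nonzeros-padded {suc m} []      _       = nonzeros-padded {m} [] z≤n
nonzeros-padded {suc m} (b ∷ w) (s≤s p) = trans (consNonzero-letter b _) (cong (b ∷_) (nonzeros-padded w p))

module HomogeneousSubcube (c : Vec (Fin 3) N → Fin 2) (θ : Thin m N)
  (homogeneous : ∀ t → t < suc m → (σ : Vec Bool t) → Homogeneous (λ ψ → c (weave ψ (letters σ))) θ)
  where

  colour-via-support : (a : Vec (Fin 3) m) →
                       c (weave θ a) ≡ c (weave (θ ⊚ support a) (letters (fromList (nonzeros a))))
  colour-via-support a =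
    cong c (trans (cong (weave θ) (sym (weave-support a))) (sym (weave-⊚ θ (support a) _)))

  -- Stated for two equal words, since support a and support a′ live in different types.
  colour-of-word : (w w′ : List Bool) → w ≡ w′ → (ψ : Thin (length w) m) (ψ′ : Thin (length w′) m) →
                   c (weave (θ ⊚ ψ) (letters (fromList w))) ≡ c (weave (θ ⊚ ψ′) (letters (fromList w′)))
  colour-of-word w .w refl ψ ψ′ with homogeneous (length w) (s≤s (thin⇒≤ ψ)) (fromList w)
  ... | b , monochromatic = trans (monochromatic ψ) (sym (monochromatic ψ′))

  colour-by-nonzeros : (a a′ : Vec (Fin 3) m) → nonzeros a ≡ nonzeros a′ →
                       c (weave θ a) ≡ c (weave θ a′)
  colour-by-nonzeros a a′ same = trans (colour-via-support a)
    (trans (colour-of-word _ _ same (support a) (support a′)) (sym (colour-via-support a′)))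

colour-factors-through-nonzeros : ∀ m → ∃[ R ] ∀ {N} → R ≤ N → (c : Vec (Fin 3) N → Fin 2) →
  Σ (Thin m N) λ θ → Σ (List Bool → Fin 2) λ G → ∀ a → c (weave θ a) ≡ G (nonzeros a)
colour-factors-through-nonzeros m with simultaneous-arities (Vec Bool) (λ t → simultaneous-Vec t) (suc m) m
... | R , homogenise = R , factor
  where
  factor : R ≤ N → (c : Vec (Fin 3) N → Fin 2) →
           Σ (Thin m N) λ θ → Σ (List Bool → Fin 2) λ G → ∀ a → c (weave θ a) ≡ G (nonzeros a)
  factor R≤N c with homogenise R≤N (λ t σ ψ → c (weave ψ (letters σ)))
  ... | θ , homogeneous = θ , (λ w → c (weave θ (padded w))) , λ a →
    HomogeneousSubcube.colour-by-nonzeros c θ homogeneous a (padded (nonzeros a))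
      (sym (nonzeros-padded (nonzeros a) (length-nonzeros a)))

-- Runs of letters

other : Fin 2 → Fin 2
other zero       = suc zero
other (suc zero) = zero

≢⇒≡other : ∀ {a b : Fin 2} → a ≢ b → a ≡ other b
≢⇒≡other {zero}     {zero}     a≢b = ⊥-elim (a≢b refl)
≢⇒≡other {zero}     {suc zero} _   = refl
≢⇒≡other {suc zero} {zero}     _   = refl
≢⇒≡other {suc zero} {suc zero} a≢b = ⊥-elim (a≢b refl)

other^ : ℕ → Fin 2 → Fin 2
other^ zero    a = a
other^ (suc k) a = other^ k (other a)

length-++-monoʳ : (xs : List A) {ys zs : List A} → length ys ≤ length zs →
                  length (xs ++ ys) ≤ length (xs ++ zs)
length-++-monoʳ xs {ys} {zs} ys≤zs = begin
  length (xs ++ ys)      ≡⟨ length-++ xs ⟩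
  length xs + length ys  ≤⟨ +-monoʳ-≤ (length xs) ys≤zs ⟩
  length xs + length zs  ≡⟨ sym (length-++ xs) ⟩
  length (xs ++ zs)      ∎
  where open ≤-Reasoning

⊎-∀-cube : ∀ {Q : Set} {P : Vec Bool d → Set} → (∀ x → Q ⊎ P x) → Q ⊎ (∀ x → P x)
⊎-∀-cube {zero}  choice with choice []
... | inj₁ q = inj₁ q
... | inj₂ p = inj₂ λ { [] → p }
⊎-∀-cube {suc d} choice with ⊎-∀-cube (choice ∘ (true ∷_)) | ⊎-∀-cube (choice ∘ (false ∷_))
... | inj₁ q    | _         = inj₁ q
... | inj₂ _    | inj₁ q    = inj₁ q
... | inj₂ on-t | inj₂ on-f = inj₂ λ { (true ∷ x) → on-t x ; (false ∷ x) → on-f x }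

fixedWord : (X : List Bool) → Template A d K → Template A d (length X + K)
fixedWord []      T = T
fixedWord (b ∷ X) T = fixed (letter b) (fixedWord X T)

nonzeros-fixedWord : (X : List Bool) (T : Template A d K) (x : Vec A d) →
                     nonzeros (instantiate (fixedWord X T) x) ≡ X ++ nonzeros (instantiate T x)
nonzeros-fixedWord []      T x = refl
nonzeros-fixedWord (b ∷ X) T x = trans (consNonzero-letter b _) (cong (b ∷_) (nonzeros-fixedWord X T x))

optional : Bool → Bool → Fin 3
optional q true  = letter q
optional q false = zero

optional-injective : ∀ q → Injective _≡_ _≡_ (optional q)
optional-injective q     {true}  {true}  _ = refl
optional-injective q     {false} {false} _ = refl
optional-injective true  {true}  {false} ()
optional-injective false {true}  {false} ()
optional-injective true  {false} {true}  ()
optional-injective false {false} {true}  ()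

freeRun : (q : Bool) → ∀ d → Template Bool 0 K → Template Bool d (d + K)
freeRun q zero    T = T
freeRun q (suc d) T = free (optional q) (optional-injective q) (freeRun q d T)

nonzeros-freeRun : ∀ q (T : Template Bool 0 K) (x : Vec Bool d) →
                   nonzeros (instantiate (freeRun q d T) x) ≡ replicate (ones x) q ++ nonzeros (instantiate T [])
nonzeros-freeRun q T []          = refl
nonzeros-freeRun q T (true ∷ x)  = trans (consNonzero-letter q _) (cong (q ∷_) (nonzeros-freeRun q T x))
nonzeros-freeRun q T (false ∷ x) = nonzeros-freeRun q T x

slot-injective : ∀ p → Injective _≡_ _≡_ (λ b → letter (b xor p))
slot-injective p     {true}  {true}  _ = refl
slot-injective p     {false} {false} _ = refl
slot-injective true  {true}  {false} ()
slot-injective false {true}  {false} ()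
slot-injective true  {false} {true}  ()
slot-injective false {false} {true}  ()

module Runs (j : ℕ) where

  run : Bool → List Bool
  run p = replicate j p

  length-run : ∀ p → length (run p) ≡ j
  length-run p = length-replicate j

  run-∷ : ∀ p (ys : List Bool) → run p ++ p ∷ ys ≡ p ∷ run p ++ ys
  run-∷ p ys = go j
    where
    go : ∀ k → replicate k p ++ p ∷ ys ≡ p ∷ replicate k p ++ ys
    go zero    = refl
    go (suc k) = cong (p ∷_) (go k)

  runs : Bool → ℕ → List Bool
  runs p zero    = []
  runs p (suc k) = run p ++ runs (not p) k

  plain : Bool → ℕ → List Bool
  plain p k = runs p (suc k)

  -- Slot letter b xor p: the letter of the preceding run if b = false, of the following run if b = true.
  slotted : Bool → Vec Bool d → List Bool
  slotted p []      = []
  slotted p (b ∷ x) = (b xor p) ∷ run (not p) ++ slotted (not p) x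

  alternating : Bool → Vec Bool d → List Bool
  alternating p x = run p ++ slotted p x

  length-runs≤slotted : ∀ p q (x : Vec Bool d) → length (runs q d) ≤ length (slotted p x)
  length-runs≤slotted p q []          = z≤n
  length-runs≤slotted {suc d} p q (b ∷ x) = begin
    length (run q ++ runs (not q) d)                   ≡⟨ length-++ (run q) ⟩
    length (run q) + length (runs (not q) d)
      ≡⟨ cong (_+ _) (trans (length-run q) (sym (length-run (not p)))) ⟩
    length (run (not p)) + length (runs (not q) d)
      ≤⟨ +-monoʳ-≤ _ (length-runs≤slotted (not p) (not q) x) ⟩
    length (run (not p)) + length (slotted (not p) x)  ≡⟨ sym (length-++ (run (not p))) ⟩
    length (run (not p) ++ slotted (not p) x)          <⟨ ≤-refl ⟩
    length (slotted p (b ∷ x))                         ∎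
    where open ≤-Reasoning

  -- The length bound is what lets a witness be realised inside a subcube of bounded dimension.
  Stable : (List Bool → Fin 2) → ℕ → Set
  Stable G B = Σ (List Bool) λ X → Σ (List Bool) λ Y → Σ Bool λ q →
    G (X ++ run q ++ Y) ≡ G (X ++ q ∷ run q ++ Y) × length (X ++ q ∷ run q ++ Y) ≤ B

  stable-≤ : ∀ {G B B′} → B ≤ B′ → Stable G B → Stable G B′
  stable-≤ B≤B′ (X , Y , q , same , bound) = X , Y , q , same , ≤-trans bound B≤B′

  stable-∷ : ∀ {G B} s → Stable (λ w → G (s ∷ w)) B → Stable G (suc B)
  stable-∷ s (X , Y , q , same , bound) = s ∷ X , Y , q , same , s≤s bound

  stable-++ : ∀ {G B} P → Stable (λ w → G (P ++ w)) B → Stable G (length P + B)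
  stable-++ {G} P (X , Y , q , same , bound) = P ++ X , Y , q ,
    trans (cong G (++-assoc P X _)) (trans same (cong G (sym (++-assoc P X _)))) ,
    subst (_≤ _) (trans (sym (length-++ P)) (cong length (sym (++-assoc P X _)))) (+-monoʳ-≤ (length P) bound)

  extend-run : (G : List Bool → Fin 2) (p b : Bool) (x : Vec Bool d) →
               Stable G (length (alternating p (b ∷ x))) ⊎
               G (run p ++ (b xor p) ∷ plain (not p) d) ≡ other (G (plain p (suc d)))
  extend-run {d} G p b x with G (run p ++ (b xor p) ∷ plain (not p) d) ≟ G (plain p (suc d))
  ... | no  differ = inj₂ (≢⇒≡other differ)
  ... | yes same   = inj₁ (witness b same)
    where
    bound : ∀ s → length (run p ++ s ∷ plain (not p) d) ≤ length (run p ++ s ∷ alternating (not p) x)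
    bound s = length-++-monoʳ (run p) (s≤s (length-++-monoʳ (run (not p)) (length-runs≤slotted (not p) _ x)))

    witness : ∀ b → G (run p ++ (b xor p) ∷ plain (not p) d) ≡ G (plain p (suc d)) →
              Stable G (length (alternating p (b ∷ x)))
    witness false same = [] , plain (not p) d , p , trans (sym same) (cong G (run-∷ p _)) ,
      subst (λ w → length w ≤ length (alternating p (false ∷ x))) (run-∷ p _) (bound p)
    witness true same = run p , runs (not (not p)) d , not p , sym same , bound (not p)

  -- The induction generalises over G: after the first slot s the word is coloured by w ↦ G (run p ++ s ∷ w).
  chain : (G : List Bool → Fin 2) (p : Bool) (x : Vec Bool d) →
          Stable G (length (alternating p x)) ⊎ G (alternating p x) ≡ other^ d (G (plain p d))
  chain G p []      = inj₂ refl
  chain {suc d} G p (b ∷ x) with chain (λ w → G (run p ++ (b xor p) ∷ w)) (not p) x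
  ... | inj₁ stable = inj₁ (subst (Stable G) (sym (length-++ (run p)))
                                   (stable-++ {G} (run p) (stable-∷ {λ w → G (run p ++ w)} (b xor p) stable)))
  ... | inj₂ same with extend-run G p b x
  ...   | inj₁ stable  = inj₁ stable
  ...   | inj₂ flipped = inj₂ (trans same (cong (other^ d) flipped))

  alternatingSize : Bool → ℕ → ℕ
  alternatingSize p zero    = length (run p) + 0
  alternatingSize p (suc d) = length (run p) + suc (alternatingSize (not p) d)

  alternatingᵀ : ∀ p d → Template Bool d (alternatingSize p d)
  alternatingᵀ p zero    = fixedWord (run p) []
  alternatingᵀ p (suc d) =
    fixedWord (run p) (free (λ b → letter (b xor p)) (slot-injective p) (alternatingᵀ (not p) d))

  nonzeros-alternatingᵀ : ∀ p (x : Vec Bool d) →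
                          nonzeros (instantiate (alternatingᵀ p d) x) ≡ alternating p x
  nonzeros-alternatingᵀ p []      = nonzeros-fixedWord (run p) [] []
  nonzeros-alternatingᵀ p (b ∷ x) = trans (nonzeros-fixedWord (run p) _ (b ∷ x)) (cong (run p ++_)
    (trans (consNonzero-letter (b xor p) _) (cong ((b xor p) ∷_) (nonzeros-alternatingᵀ (not p) x))))

  stable-or-alternating : (G : List Bool → Fin 2) (d : ℕ) →
    Stable G (alternatingSize true d) ⊎
    ∃[ χ ] ∀ x → G (nonzeros (instantiate (alternatingᵀ true d) x)) ≡ χ
  stable-or-alternating G d = Sum.map₂ (other^ d (G (plain true d)) ,_) (⊎-∀-cube λ x →
    Sum.map (stable-≤ {G} (bound x)) (trans (cong G (nonzeros-alternatingᵀ true x))) (chain G true x))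
    where
    bound : (x : Vec Bool d) → length (alternating true x) ≤ alternatingSize true d
    bound x = subst (λ w → length w ≤ alternatingSize true d) (nonzeros-alternatingᵀ true x)
                    (length-nonzeros (instantiate (alternatingᵀ true d) x))

  stableᵀ : (X Y : List Bool) (q : Bool) (d : ℕ) → Template Bool d (length X + (d + (length Y + 0)))
  stableᵀ X Y q d = fixedWord X (freeRun q d (fixedWord Y []))

  nonzeros-stableᵀ : ∀ X Y q (x : Vec Bool d) →
                     nonzeros (instantiate (stableᵀ X Y q d) x) ≡ X ++ replicate (ones x) q ++ Y
  nonzeros-stableᵀ {d} X Y q x = begin
    nonzeros (instantiate (stableᵀ X Y q d) x)                   ≡⟨ nonzeros-fixedWord X _ x ⟩
    X ++ nonzeros (instantiate (freeRun q d (fixedWord Y [])) x) ≡⟨ cong (X ++_) (nonzeros-freeRun q _ x) ⟩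
    X ++ replicate (ones x) q ++ nonzeros (instantiate (fixedWord Y []) [])
      ≡⟨ cong (λ w → X ++ replicate (ones x) q ++ w) (trans (nonzeros-fixedWord Y [] []) (++-identityʳ Y)) ⟩
    X ++ replicate (ones x) q ++ Y                               ∎
    where open ≡-Reasoning

  stableᵀ-fits : ∀ {X Y q B} d → length (X ++ q ∷ run q ++ Y) ≤ B →
                 length X + (d + (length Y + 0)) ≤ B + d
  stableᵀ-fits {X} {Y} {q} {B} d bound = begin
    length X + (d + (length Y + 0))                   ≡⟨ rearrange (length X) d (length Y) ⟩
    length X + length Y + d
      ≤⟨ +-monoˡ-≤ d (+-monoʳ-≤ (length X) (m≤n+m _ _)) ⟩
    length X + (suc (length (run q)) + length Y) + d  ≡⟨ cong (_+ d) (sym length-word) ⟩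
    length (X ++ q ∷ run q ++ Y) + d                  ≤⟨ +-monoˡ-≤ d bound ⟩
    B + d                                             ∎
    where
    open ≤-Reasoning
    open +-*-Solver
    rearrange : ∀ x d y → x + (d + (y + 0)) ≡ x + y + d
    rearrange = solve 3 (λ x d y → x :+ (d :+ (y :+ con 0)) := x :+ y :+ d) refl
    length-word : length (X ++ q ∷ run q ++ Y) ≡ length X + (suc (length (run q)) + length Y)
    length-word = trans (length-++ X) (cong (λ l → length X + suc l) (length-++ (run q)))

-- Cubes with a monochromatic edge layer

record MonochromaticLayerCube (d j N : ℕ) (c : Colouring N) : Set where
  field
    embedding     : QVertex d → K3Vertex N
    induced       : InducedEmbedding embedding
    colour        : Fin 2
    monochromatic : ∀ x → InEdgeLayer j x → c (embedding x) ≡ colour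

cube-from-template : (c : Colouring N) (θ : Thin m N) (G : List Bool → Fin 2) →
  (∀ a → c (weave θ a) ≡ G (nonzeros a)) → (T : Template Bool d K) → K ≤ m → (χ : Fin 2) →
  (∀ x → InEdgeLayer j x → G (nonzeros (instantiate T x)) ≡ χ) → MonochromaticLayerCube d j N c
cube-from-template c θ G factors T K≤m χ on-layer = record
  { embedding     = weave (θ ⊚ ι) ∘ instantiate T
  ; induced       = induced-∘ (instantiate-induced (thinning (θ ⊚ ι))) (instantiate-induced T)
  ; colour        = χ
  ; monochromatic = λ x layer → begin
      c (weave (θ ⊚ ι) (instantiate T x))        ≡⟨ cong c (weave-⊚ θ ι _) ⟩
      c (weave θ (weave ι (instantiate T x)))    ≡⟨ factors _ ⟩
      G (nonzeros (weave ι (instantiate T x)))   ≡⟨ cong G (nonzeros-weave ι _) ⟩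
      G (nonzeros (instantiate T x))             ≡⟨ on-layer x layer ⟩
      χ                                          ∎
  }
  where
  open ≡-Reasoning
  ι = initial K≤m

cube-with-monochromatic-layer : ∀ d j → ∃[ N₀ ] ∀ {N} → N₀ ≤ N → (c : Colouring N) →
                                MonochromaticLayerCube d j N c
cube-with-monochromatic-layer d j with colour-factors-through-nonzeros (Runs.alternatingSize j true d + d)
... | N₀ , factor = N₀ , cube
  where
  open Runs j
  cube : N₀ ≤ N → (c : Colouring N) → MonochromaticLayerCube d j N c
  cube N₀≤N c with factor N₀≤N c
  ... | θ , G , factors with stable-or-alternating G d
  ... | inj₂ (χ , constant) =
    cube-from-template c θ G factors (alternatingᵀ true d) (m≤m+n _ d) χ (λ x _ → constant x)
  ... | inj₁ (X , Y , q , same , bound) =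
    cube-from-template c θ G factors (stableᵀ X Y q d) (stableᵀ-fits {X} {Y} {q} d bound)
                       (G (X ++ run q ++ Y)) on-layer
    where
    word : (x : Vec Bool d) → ∀ {k} → ones x ≡ k →
           nonzeros (instantiate (stableᵀ X Y q d) x) ≡ X ++ replicate k q ++ Y
    word x ones≡k = trans (nonzeros-stableᵀ X Y q x) (cong (λ k → X ++ replicate k q ++ Y) ones≡k)

    on-layer : ∀ x → InEdgeLayer j x → G (nonzeros (instantiate (stableᵀ X Y q d) x)) ≡ G (X ++ run q ++ Y)
    on-layer x (inj₁ ones≡j)   = cong G (word x ones≡j)
    on-layer x (inj₂ ones≡1+j) = trans (cong G (word x ones≡1+j)) (sym same)

copy-into-cube : (H : Graph n) (f : Fin n → QVertex d) → Injective _≡_ _≡_ f →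
                 (∀ v → InEdgeLayer j (f v)) → (∀ u v → Adj H u v → QAdj (f u) (f v)) →
                 {c : Colouring N} → MonochromaticLayerCube d j N c → MonoCopy H N c
copy-into-cube H f f-injective f-layer f-adjacent cube =
  embedding ∘ f , f-injective ∘ injective ,
  (λ u v → preserves-differInOne ∘ f-adjacent u v) ,
  colour , λ v → monochromatic (f v) (f-layer v)
  where
  open MonochromaticLayerCube cube
  open InducedEmbedding induced

induced-copy-into-cube : (H : Graph n) (f : Fin n → QVertex d) → Injective _≡_ _≡_ f →
                         (∀ v → InEdgeLayer j (f v)) → (∀ u v → Adj H u v ⇔ QAdj (f u) (f v)) →
                         {c : Colouring N} → MonochromaticLayerCube d j N c → MonoInducedCopy H N c
induced-copy-into-cube H f f-injective f-layer f-adjacent cube =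
  embedding ∘ f , f-injective ∘ injective ,
  (λ u v → mk⇔ (preserves-differInOne ∘ Equivalence.to (f-adjacent u v))
               (Equivalence.from (f-adjacent u v) ∘ reflects-differInOne)) ,
  colour , λ v → monochromatic (f v) (f-layer v)
  where
  open MonochromaticLayerCube cube
  open InducedEmbedding induced

theorem1p4 : ((n : ℕ) (H : Graph n) → Layered H →
    ∃[ N₀ ] ∀ N → N ≥ N₀ → ∀ (c : Colouring N) → MonoCopy H N c)
    × ((n : ℕ) (H : Graph n) → InducedLayered H →
    ∃[ N₀ ] ∀ N → N ≥ N₀ → ∀ (c : Colouring N) → MonoInducedCopy H N c)
theorem1p4 = copy , induced-copy
  where
  copy : (n : ℕ) (H : Graph n) → Layered H →
         ∃[ N₀ ] ∀ N → N ≥ N₀ → ∀ (c : Colouring N) → MonoCopy H N c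
  copy n H (d , j , f , f-injective , f-layer , f-adjacent) with cube-with-monochromatic-layer d j
  ... | N₀ , cube = N₀ , λ N N≥N₀ c → copy-into-cube H f f-injective f-layer f-adjacent (cube N≥N₀ c)

  induced-copy : (n : ℕ) (H : Graph n) → InducedLayered H →
                 ∃[ N₀ ] ∀ N → N ≥ N₀ → ∀ (c : Colouring N) → MonoInducedCopy H N c
  induced-copy n H (d , j , f , f-injective , f-layer , f-adjacent) with cube-with-monochromatic-layer d j
  ... | N₀ , cube = N₀ , λ N N≥N₀ c →
    induced-copy-into-cube H f f-injective f-layer f-adjacent (cube N≥N₀ c)
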